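{- Let $P_n$ be the path on $n$ vertices and let $0<\beta<\tfrac12$. Then $\beta\text{ -pack}(P_n)=0$.
   Context: Let $G=(V,E)$ be a graph, $N(v)=\{u : uv\in E\}$ the open neighborhood of $v$, and fix $\beta$ with $0<\beta\le 1$. A set $S\subsetneq V$ (a proper subset) is a $\beta$-packing set of $G$ if (i) for every $v\in V-S$, $|N(v)\cap S|\le \beta\,|N(v)|$, and (ii) $S$ is maximal with respect to inclusion among proper subsets of $V$ having property (i). The $\beta$-packing number $\beta\text{ -pack}(G)$ is the maximum cardinality of a $\beta$-packing set of $G$.
   Formalization: The parameter β ranges only over the rationals. -}

module Defs where

open import Data.Nat using (ℕ; _≤_; _≡ᵇ_) renaming (_+_ to _+ℕ_)
open import Data.Bool using (Bool; _∨_)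
open import Data.Fin using (Fin; toℕ)
open import Data.Fin.Subset using (Subset; _∈_; _∉_; _⊆_; _∩_; ∣_∣; ⊤)
open import Data.Vec using (tabulate)
open import Data.Integer using (+_)
open import Data.Product using (Σ; _×_; ∃)
open import Relation.Binary.PropositionalEquality using (_≡_)
open import Relation.Nullary using (¬_)
import Data.Rational as ℚ
open ℚ using (ℚ)

Graph : ℕ → Set
Graph n = Fin n → Fin n → Bool

path : (n : ℕ) → Graph n
path n i j = (toℕ i +ℕ 1 ≡ᵇ toℕ j) ∨ (toℕ j +ℕ 1 ≡ᵇ toℕ i)

N : ∀ {n} → Graph n → Fin n → Subset n
N G v = tabulate (G v)

ℕ→ℚ : ℕ → ℚ
ℕ→ℚ k = (+ k) ℚ./ 1

Property-i : ∀ {n} → Graph n → ℚ → Subset n → Set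
Property-i {n} G β S =
  (v : Fin n) → v ∉ S → ℕ→ℚ ∣ N G v ∩ S ∣ ℚ.≤ β ℚ.* ℕ→ℚ ∣ N G v ∣

Proper : ∀ {n} → Subset n → Set
Proper {n} S = ∃ λ (v : Fin n) → v ∉ S

IsβPacking : ∀ {n} → Graph n → ℚ → Subset n → Set
IsβPacking G β S =
  Proper S × Property-i G β S ×
  (∀ T → Proper T → Property-i G β T → S ⊆ T → T ≡ S)

βpack≡ : ∀ {n} → Graph n → ℚ → ℕ → Set
βpack≡ G β m =
  (Σ _ λ S → IsβPacking G β S × ∣ S ∣ ≡ m) ×
  (∀ S → IsβPacking G β S → ∣ S ∣ ≤ m)

-- A vertex outside S with a neighbour in S has at least half of its (at most two) neighbours
-- in S, which property (i) forbids when β < ½. So the complement of a set with property (i)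
-- is closed under adjacency, and since the path is connected a proper such set is empty;
-- thus ∅ is the only β-packing set.

module Submission where

open import Defs
open import Data.Nat using (ℕ; zero; suc; _+_; _≡ᵇ_; _≥_; z≤n; s≤s) renaming (_≤_ to _≤ℕ_)
open import Data.Nat.Properties using (≤-trans; ≤-reflexive; +-mono-≤; +-suc; +-monoʳ-≤; n≤1+n; +-comm; +-cancelʳ-≡; ≡ᵇ⇒≡; ≡⇒≡ᵇ)
open import Data.Bool using (Bool; true; _∨_)
open import Data.Bool.Properties using (T-≡; ∨-comm)
open import Data.Fin using (Fin; toℕ; inject₁) renaming (zero to fzero; suc to fsuc)
open import Data.Fin.Properties using (toℕ-inject₁; toℕ-injective; suc-injective; 0≢1+n)
open import Data.Fin.Induction using (<-weakInduction)
open import Data.Fin.Subset using (Subset; inside; outside; _∈_; _∉_; _∩_; _∪_; ∣_∣; ⊥)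
open import Data.Fin.Subset.Properties using (∣⊥∣≡0; Empty-unique; x∈p∩q⁺; x∈p⇒∣p-x∣<∣p∣; ∣p∩q∣≤∣p∣; ∩-zeroʳ; ∉⊥)
open import Data.Vec using ([]; _∷_; tabulate; here; there)
open import Data.Vec.Properties using (lookup∘tabulate; lookup⇒[]=; []=⇒lookup)
open import Data.Rational using (ℚ; 0ℚ; 1ℚ; ½; _<_; _≤_; _*_; nonNegative)
open import Data.Rational.Properties using (<⇒≤; <-irrefl; <-trans; ≤-<-trans; _<?_; *-identityʳ; *-monoˡ-<-pos; nonNeg*nonNeg⇒nonNeg; nonNegative⁻¹; normalize-nonNeg)
open import Data.Product using (_,_)
open import Function using (id; _⇔_; mk⇔; Equivalence)
open Equivalence using (to; from)
open import Relation.Binary.PropositionalEquality using (_≡_; refl; sym; trans; cong; subst)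
open import Relation.Nullary.Decidable using (toWitness)

∣p∪q∣≤∣p∣+∣q∣ : ∀ {n} (p q : Subset n) → ∣ p ∪ q ∣ ≤ℕ ∣ p ∣ + ∣ q ∣
∣p∪q∣≤∣p∣+∣q∣ [] [] = z≤n
∣p∪q∣≤∣p∣+∣q∣ (outside ∷ p) (outside ∷ q) = ∣p∪q∣≤∣p∣+∣q∣ p q
∣p∪q∣≤∣p∣+∣q∣ (inside ∷ p) (outside ∷ q) = s≤s (∣p∪q∣≤∣p∣+∣q∣ p q)
∣p∪q∣≤∣p∣+∣q∣ (outside ∷ p) (inside ∷ q) =
  ≤-trans (s≤s (∣p∪q∣≤∣p∣+∣q∣ p q)) (≤-reflexive (sym (+-suc ∣ p ∣ ∣ q ∣)))
∣p∪q∣≤∣p∣+∣q∣ (inside ∷ p) (inside ∷ q) =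
  s≤s (≤-trans (∣p∪q∣≤∣p∣+∣q∣ p q) (+-monoʳ-≤ ∣ p ∣ (n≤1+n ∣ q ∣)))

∣p∣≤1 : ∀ {n} (p : Subset n) → (∀ {x y} → x ∈ p → y ∈ p → x ≡ y) → ∣ p ∣ ≤ℕ 1
∣p∣≤1 [] _ = z≤n
∣p∣≤1 (outside ∷ p) unique = ∣p∣≤1 p λ x∈p y∈p → suc-injective (unique (there x∈p) (there y∈p))
∣p∣≤1 {suc n} (inside ∷ p) unique =
  s≤s (≤-reflexive (trans (cong ∣_∣ p≡⊥) (∣⊥∣≡0 n)))
  where
    p≡⊥ : p ≡ ⊥
    p≡⊥ = Empty-unique λ { (x , x∈p) → 0≢1+n (unique here (there x∈p)) }

tabulate-∨ : ∀ {n} (f g : Fin n → Bool) → tabulate (λ j → f j ∨ g j) ≡ tabulate f ∪ tabulate g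
tabulate-∨ {zero} f g = refl
tabulate-∨ {suc n} f g = cong ((f fzero ∨ g fzero) ∷_) (tabulate-∨ (λ j → f (fsuc j)) (λ j → g (fsuc j)))

∈-tabulate⁺ : ∀ {n} {f : Fin n → Bool} {x} → f x ≡ true → x ∈ tabulate f
∈-tabulate⁺ {f = f} {x} fx = lookup⇒[]= x (tabulate f) (trans (lookup∘tabulate f x) fx)

∈-tabulate⁻ : ∀ {n} {f : Fin n → Bool} {x} → x ∈ tabulate f → f x ≡ true
∈-tabulate⁻ {f = f} {x} x∈ = trans (sym (lookup∘tabulate f x)) ([]=⇒lookup x∈)

β*c<k : ∀ {β} → β < ½ → ∀ {k c} → 1 ≤ℕ k → k ≤ℕ c → c ≤ℕ 2 → β * ℕ→ℚ c < ℕ→ℚ k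
β*c<k {β} β<½ {1} {1} _ _ _ = subst (_< 1ℚ) (sym (*-identityʳ β)) (<-trans β<½ (toWitness {a? = ½ <? 1ℚ} _))
β*c<k β<½ {1} {2} _ _ _ = *-monoˡ-<-pos (ℕ→ℚ 2) β<½
β*c<k β<½ {2} {2} _ _ _ = <-trans (*-monoˡ-<-pos (ℕ→ℚ 2) β<½) (toWitness {a? = 1ℚ <? ℕ→ℚ 2} _)
β*c<k β<½ {2} {1} _ (s≤s ()) _
β*c<k β<½ {suc (suc (suc _))} (s≤s _) (s≤s (s≤s (s≤s _))) (s≤s (s≤s ()))
β*c<k β<½ {1} {suc (suc (suc _))} _ _ (s≤s (s≤s ()))
β*c<k β<½ {2} {suc (suc (suc _))} _ _ (s≤s (s≤s ()))

0≤β*c : ∀ {β} → 0ℚ ≤ β → ∀ c → 0ℚ ≤ β * ℕ→ℚ c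
0≤β*c {β} 0≤β c =
  nonNegative⁻¹ _ {{nonNeg*nonNeg⇒nonNeg β {{nonNegative 0≤β}} (ℕ→ℚ c) {{normalize-nonNeg c 1}}}}

≡ᵇ-true⇒≡ : ∀ m n → (m ≡ᵇ n) ≡ true → m ≡ n
≡ᵇ-true⇒≡ m n eq = ≡ᵇ⇒≡ m n (from T-≡ eq)

∣N-path∣≤2 : ∀ n (v : Fin n) → ∣ N (path n) v ∣ ≤ℕ 2
∣N-path∣≤2 n v = ≤-trans (≤-reflexive (cong ∣_∣ (tabulate-∨ successor predecessor)))
  (≤-trans (∣p∪q∣≤∣p∣+∣q∣ (tabulate successor) (tabulate predecessor))
    (+-mono-≤ (∣p∣≤1 _ successor-unique) (∣p∣≤1 _ predecessor-unique)))
  where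
    successor predecessor : Fin n → Bool
    successor j = toℕ v + 1 ≡ᵇ toℕ j
    predecessor j = toℕ j + 1 ≡ᵇ toℕ v

    successor-unique : ∀ {x y} → x ∈ tabulate successor → y ∈ tabulate successor → x ≡ y
    successor-unique {x} {y} x∈ y∈ = toℕ-injective (trans
      (sym (≡ᵇ-true⇒≡ (toℕ v + 1) (toℕ x) (∈-tabulate⁻ x∈)))
      (≡ᵇ-true⇒≡ (toℕ v + 1) (toℕ y) (∈-tabulate⁻ y∈)))

    predecessor-unique : ∀ {x y} → x ∈ tabulate predecessor → y ∈ tabulate predecessor → x ≡ y
    predecessor-unique {x} {y} x∈ y∈ = toℕ-injective (+-cancelʳ-≡ 1 (toℕ x) (toℕ y) (trans
      (≡ᵇ-true⇒≡ (toℕ x + 1) (toℕ v) (∈-tabulate⁻ x∈))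
      (sym (≡ᵇ-true⇒≡ (toℕ y + 1) (toℕ v) (∈-tabulate⁻ y∈)))))

path-sym : ∀ {n} (u w : Fin n) → path n u w ≡ path n w u
path-sym u w = ∨-comm (toℕ u + 1 ≡ᵇ toℕ w) (toℕ w + 1 ≡ᵇ toℕ u)

path-edge : ∀ {n} (i : Fin n) → path (suc n) (inject₁ i) (fsuc i) ≡ true
path-edge i =
  cong (_∨ (toℕ (fsuc i) + 1 ≡ᵇ toℕ (inject₁ i)))
       (to T-≡ (≡⇒≡ᵇ _ _ (trans (cong (_+ 1) (toℕ-inject₁ i)) (+-comm (toℕ i) 1))))

path-connected : ∀ {n} (P : Fin n → Set) → (∀ {u w} → path n u w ≡ true → P u → P w) →
                 ∀ {u} → P u → ∀ w → P w
path-connected {suc n} P closed {u} Pu w = from (P⇔P₀ w) (to (P⇔P₀ u) Pu)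
  where
    P⇔P₀ : ∀ i → P i ⇔ P fzero
    P⇔P₀ = <-weakInduction (λ i → P i ⇔ P fzero) (mk⇔ id id) λ i Pi⇔P₀ →
      mk⇔ (λ P[i+1] → to Pi⇔P₀ (closed (trans (path-sym (fsuc i) (inject₁ i)) (path-edge i)) P[i+1]))
          (λ P₀ → closed (path-edge i) (from Pi⇔P₀ P₀))

outside-closed : ∀ {n} (G : Graph n) {β S} → (∀ v → ∣ N G v ∣ ≤ℕ 2) → β < ½ → Property-i G β S →
                 ∀ {u w} → G u w ≡ true → u ∉ S → w ∉ S
outside-closed G {S = S} deg≤2 β<½ property-i {u} uw u∉S w∈S =
  <-irrefl refl (≤-<-trans (property-i u u∉S) (β*c<k β<½ 1≤∣N∩S∣ (∣p∩q∣≤∣p∣ (N G u) S) (deg≤2 u)))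
  where
    1≤∣N∩S∣ : 1 ≤ℕ ∣ N G u ∩ S ∣
    1≤∣N∩S∣ = ≤-trans (s≤s z≤n) (x∈p⇒∣p-x∣<∣p∣ (x∈p∩q⁺ (∈-tabulate⁺ uw , w∈S)))

path-proper⇒≡⊥ : ∀ {n β S} → β < ½ → Proper S → Property-i (path n) β S → S ≡ ⊥
path-proper⇒≡⊥ {n} {S = S} β<½ (v , v∉S) property-i = Empty-unique λ { (w , w∈S) →
  path-connected (_∉ S) (outside-closed (path n) (∣N-path∣≤2 n) β<½ property-i) v∉S w w∈S }

⊥-property-i : ∀ {n} (G : Graph n) {β} → 0ℚ ≤ β → Property-i G β ⊥
⊥-property-i {n} G {β} 0≤β v _ =
  subst (λ k → ℕ→ℚ k ≤ β * ℕ→ℚ ∣ N G v ∣)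
        (sym (trans (cong ∣_∣ (∩-zeroʳ (N G v))) (∣⊥∣≡0 n)))
        (0≤β*c 0≤β ∣ N G v ∣)

proposition2p3 : (n : ℕ) → n ≥ 1 → (β : ℚ) → 0ℚ < β → β < ½ → βpack≡ (path n) β 0
proposition2p3 (suc n) _ β 0<β β<½ = (⊥ , ⊥-packing , ∣⊥∣≡0 (suc n)) , packing-size≤0
  where
    ⊥-packing : IsβPacking (path (suc n)) β ⊥
    ⊥-packing = (fzero , ∉⊥) , ⊥-property-i (path (suc n)) (<⇒≤ 0<β) ,
                λ T proper property-i _ → path-proper⇒≡⊥ β<½ proper property-i

    packing-size≤0 : ∀ S → IsβPacking (path (suc n)) β S → ∣ S ∣ ≤ℕ 0
    packing-size≤0 S (proper , property-i , _) =
      ≤-reflexive (trans (cong ∣_∣ (path-proper⇒≡⊥ β<½ proper property-i)) (∣⊥∣≡0 (suc n)))
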